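{- Let $\{G_i\}_{i\ge1}$ be a family of connected graphs with $G_i$ having $i$ vertices, and for a partition $\lambda=(\lambda_1,\dots,\lambda_\ell)$ let $G_\lambda=G_{\lambda_1}\cup\dots\cup G_{\lambda_\ell}$ (disjoint union). Let $G$ be a graph with $n$ vertices. Then \[\sum_{\lambda\vdash n}[X_{G_\lambda}]X_G=1,\] where $[X_{G_\lambda}]X_G$ is the coefficient of $X_{G_\lambda}$ in the expansion of $X_G$ in the basis $\{X_{G_\lambda}\}$.
   Context: All graphs are finite and simple. $X_G=\sum_\kappa\prod_{v\in V(G)}x_{\kappa(v)}$, summing over proper colourings $\kappa:V(G)\to\mathbb{Z}_{>0}$, is the chromatic symmetric function. It is a known fact that for any such family of connected graphs $G_i$ on $i$ vertices, $\{X_{G_\lambda}\}$ over all partitions $\lambda$ is a basis of the algebra of symmetric functions over $\mathbb{Q}$. -}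

module Defs where

open import Data.Nat using (ℕ; zero; suc; _+_; _≥_; _<_)
open import Data.Fin using (Fin; zero; suc; splitAt)
open import Data.Fin.Properties using () renaming (_≟_ to _≟ᶠ_)
open import Data.Bool using (Bool; true; false; not; _∧_; _∨_)
open import Data.Sum using (_⊎_; inj₁; inj₂)
open import Data.Product using (_×_; _,_)
open import Data.List using (List; []; _∷_; map; concatMap; allFin; filter; length; foldr)
open import Data.Nat.ListAction using (sum)
open import Data.Bool.ListAction using (and)
open import Data.List.Relation.Unary.All using (All)
open import Data.List.Relation.Unary.Linked using (Linked)
open import Data.Integer using (+_)
open import Data.Rational using (ℚ; _/_; 0ℚ) renaming (_+_ to _+ℚ_; _*_ to _*ℚ_)
open import Relation.Nullary.Decidable using (⌊_⌋; does)
open import Relation.Binary.PropositionalEquality using (_≡_; refl)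
open import Data.Nat using () renaming (_≟_ to _≟ℕ_)

record Graph (n : ℕ) : Set where
  field
    adj   : Fin n → Fin n → Bool
    sym   : ∀ u v → adj u v ≡ adj v u
    irrfl : ∀ u → adj u u ≡ false
open Graph public

data Reach {n : ℕ} (G : Graph n) : Fin n → Fin n → Set where
  here : ∀ {u} → Reach G u u
  step : ∀ {u w v} → adj G u w ≡ true → Reach G w v → Reach G u v

Connected : ∀ {n} → Graph n → Set
Connected G = ∀ u v → Reach G u v

private
  adjS : ∀ {a b} → Graph a → Graph b → Fin a ⊎ Fin b → Fin a ⊎ Fin b → Bool
  adjS G H (inj₁ x) (inj₁ y) = adj G x y
  adjS G H (inj₂ x) (inj₂ y) = adj H x y
  adjS G H (inj₁ x) (inj₂ y) = false
  adjS G H (inj₂ x) (inj₁ y) = false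

  adjS-sym : ∀ {a b} (G : Graph a) (H : Graph b) x y → adjS G H x y ≡ adjS G H y x
  adjS-sym G H (inj₁ x) (inj₁ y) = sym G x y
  adjS-sym G H (inj₂ x) (inj₂ y) = sym H x y
  adjS-sym G H (inj₁ x) (inj₂ y) = refl
  adjS-sym G H (inj₂ x) (inj₁ y) = refl

  adjS-irr : ∀ {a b} (G : Graph a) (H : Graph b) x → adjS G H x x ≡ false
  adjS-irr G H (inj₁ x) = irrfl G x
  adjS-irr G H (inj₂ x) = irrfl H x

_⊔_ : ∀ {a b} → Graph a → Graph b → Graph (a + b)
_⊔_ {a} G H = record
  { adj   = λ u v → adjS G H (splitAt a u) (splitAt a v)
  ; sym   = λ u v → adjS-sym G H (splitAt a u) (splitAt a v)
  ; irrfl = λ u → adjS-irr G H (splitAt a u) }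

emptyGraph : Graph 0
emptyGraph = record { adj = λ () ; sym = λ () ; irrfl = λ () }

unionFamily : (Gs : (i : ℕ) → Graph i) → (λs : List ℕ) → Graph (sum λs)
unionFamily Gs []       = emptyGraph
unionFamily Gs (k ∷ ks) = Gs k ⊔ unionFamily Gs ks

IsPartition : ℕ → List ℕ → Set
IsPartition n l = Linked _≥_ l × All (0 <_) l × sum l ≡ n

allFuns : (n m : ℕ) → List (Fin n → Fin m)
allFuns zero    m = (λ ()) ∷ []
allFuns (suc n) m = concatMap (λ f → map (λ i → cons i f) (allFin m)) (allFuns n m)
  where
  cons : ∀ {n m} → Fin m → (Fin n → Fin m) → Fin (suc n) → Fin m
  cons i f zero    = i
  cons i f (suc k) = f k

isProper : ∀ {n m} → Graph n → (Fin n → Fin m) → Bool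
isProper {n} G κ =
  and (concatMap (λ u → map (λ v → not (adj G u v) ∨ not ⌊ κ u ≟ᶠ κ v ⌋) (allFin n)) (allFin n))

fibreSize : ∀ {n m} → (Fin n → Fin m) → Fin m → ℕ
fibreSize {n} κ i = length (filter (λ v → κ v ≟ᶠ i) (allFin n))

hasContent : ∀ {n m} → (Fin n → Fin m) → (Fin m → ℕ) → Bool
hasContent {n} {m} κ α = and (map (λ i → ⌊ fibreSize κ i ≟ℕ α i ⌋) (allFin m))

-- Coefficient of the monomial x₁^{α₁} ⋯ x_m^{α_m} in X_G
-- (the number of proper colourings κ with |κ⁻¹(i)| = α i).
-- Every monomial of the formal power series X_G in x₁, x₂, … arises this
-- way for a suitable m (pad α with zeros).
chromCoeff : ∀ {n} → Graph n → (m : ℕ) → (Fin m → ℕ) → ℕ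
chromCoeff {n} G m α =
  length (filter (λ κ → isProper G κ ∧ hasContent κ α ≟B true) (allFuns n m))
  where
  open import Data.Bool.Properties using () renaming (_≟_ to _≟B_)

ℕtoℚ : ℕ → ℚ
ℕtoℚ k = (+ k) / 1

sumℚ : List ℚ → ℚ
sumℚ = foldr _+ℚ_ 0ℚ

-- Compare the coefficient of x₁x₂⋯xₙ on both sides of the expansion. A colouring with
-- this content is a bijection onto the colours, hence proper for every graph, so that
-- coefficient is n! in X_H for every graph H on n vertices: for G and for each G_λ with
-- λ ⊢ n alike. Hence n! = (Σ_λ c_λ) n!. Only |V(G_λ)| = n is used.

module Submission where

open import Defs hiding (sym)
open import Data.Bool using (Bool; true; false; T; not; _∧_; _∨_)
open import Data.Bool.ListAction using (and)
open import Data.Bool.Properties using (T-≡; T-∨; ∧-zeroʳ; ∧-identityʳ) renaming (_≟_ to _≟B_)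
open import Data.Empty using (⊥-elim)
open import Data.Fin using (Fin; zero; suc)
open import Data.Fin.Properties using () renaming (_≟_ to _≟ᶠ_)
open import Data.List using (List; []; _∷_; map; allFin; filter; length)
open import Data.List.Membership.Propositional using (_∈_)
open import Data.List.Membership.Propositional.Properties using (∈-allFin; ∈-filter⁺; ∈-filter⁻; ∈-length)
open import Data.List.Properties using (filter-≐; filter-some; map-cong-local)
open import Data.List.Relation.Unary.All as All using (All; []; _∷_)
open import Data.List.Relation.Unary.All.Properties using (all⁺; all⁻; concat⁺; map⁺)
open import Data.List.Relation.Unary.AllPairs using ([]; _∷_)
open import Data.List.Relation.Unary.Any as Any using (Any; here; there)
import Data.List.Relation.Unary.Any.Properties as Anyₚ
open import Data.List.Relation.Unary.Unique.Propositional using (Unique)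
import Data.List.Relation.Unary.Unique.Propositional.Properties as Uniqueₚ
open import Data.Nat using (ℕ; zero; suc; _≤_; _<_; z≤n; s≤s) renaming (_≟_ to _≟ℕ_)
open import Data.Nat.Properties using (≤-refl; ≤-antisym; m≤n⇒m≤1+n; 1+n≰n)
open import Data.Product using (_×_; _,_; proj₁; proj₂)
open import Data.Sum using (inj₂)
open import Data.Rational using (ℚ; 1ℚ; _*_; _+_; Positive)
open import Data.Rational.Properties using (*-identityˡ; *-zeroˡ; *-distribʳ-+; *-cancelʳ-≤-pos; normalize-pos)
import Data.Rational.Properties as ℚₚ
open import Function using (_∘_; id; const; Equivalence)
open import Function.Definitions using (Injective)
open import Relation.Binary.Definitions using (DecidableEquality)
open import Relation.Nullary using (yes; no)
open import Relation.Nullary.Decidable using (⌊_⌋; toWitness; fromWitness)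
open import Relation.Binary.PropositionalEquality
  using (_≡_; _≢_; _≗_; refl; sym; trans; cong; subst; module ≡-Reasoning)

∈-distinct⇒2≤length : ∀ {A : Set} {xs : List A} {u v : A} →
  u ∈ xs → v ∈ xs → u ≢ v → 2 ≤ length xs
∈-distinct⇒2≤length (here refl) (here refl) u≢v = ⊥-elim (u≢v refl)
∈-distinct⇒2≤length (here refl) (there v∈)  _   = s≤s (∈-length v∈)
∈-distinct⇒2≤length (there u∈)  (here refl) _   = s≤s (∈-length u∈)
∈-distinct⇒2≤length (there u∈)  (there v∈)  u≢v = m≤n⇒m≤1+n (∈-distinct⇒2≤length u∈ v∈ u≢v)

unique-constant⇒length≤1 : ∀ {A : Set} {xs : List A} {x : A} →
  Unique xs → All (_≡ x) xs → length xs ≤ 1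
unique-constant⇒length≤1 {xs = []}    _ _ = z≤n
unique-constant⇒length≤1 {xs = _ ∷ []} _ _ = ≤-refl
unique-constant⇒length≤1 {xs = _ ∷ _ ∷ _} ((y≢z ∷ _) ∷ _) (refl ∷ refl ∷ _) = ⊥-elim (y≢z refl)

unique⇒count-member≡1 : ∀ {A : Set} (_≟_ : DecidableEquality A) {xs : List A} {x : A} →
  Unique xs → x ∈ xs → length (filter (_≟ x) xs) ≡ 1
unique⇒count-member≡1 _≟_ {xs} {x} unique x∈ = ≤-antisym
  (unique-constant⇒length≤1 (Uniqueₚ.filter⁺ (_≟ x) unique)
    (All.tabulate (λ v∈ → proj₂ (∈-filter⁻ (_≟ x) {xs = xs} v∈))))
  (filter-some (_≟ x) (Any.map sym x∈))

T-and : ∀ {bs : List Bool} → All T bs → T (and bs)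
T-and {[]}         []       = _
T-and {true ∷ _}   (_ ∷ ts) = T-and ts
T-and {false ∷ _}  (() ∷ _)

module _ {n m : ℕ} (κ : Fin n → Fin m) (α : Fin m → ℕ) where

  private
    fibreSizeIs : Fin m → Bool
    fibreSizeIs i = ⌊ fibreSize κ i ≟ℕ α i ⌋

  hasContent⇒fibreSize : T (hasContent κ α) → ∀ i → fibreSize κ i ≡ α i
  hasContent⇒fibreSize h i =
    toWitness (All.lookup (all⁺ fibreSizeIs (allFin m) h) (∈-allFin i))

  fibreSize⇒hasContent : (∀ i → fibreSize κ i ≡ α i) → T (hasContent κ α)
  fibreSize⇒hasContent h =
    all⁻ fibreSizeIs {xs = allFin m} (All.tabulate λ {i} _ → fromWitness (h i))

hasContent-ones⇒injective : ∀ {n m} {κ : Fin n → Fin m} →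
  T (hasContent κ (const 1)) → Injective _≡_ _≡_ κ
hasContent-ones⇒injective {κ = κ} h {u} {v} κu≡κv with u ≟ᶠ v
... | yes u≡v = u≡v
... | no  u≢v = ⊥-elim (1+n≰n (subst (2 ≤_) (hasContent⇒fibreSize κ (const 1) h (κ v)) fibre≥2))
  where
  fibre≥2 : 2 ≤ fibreSize κ (κ v)
  fibre≥2 = ∈-distinct⇒2≤length (∈-filter⁺ (λ w → κ w ≟ᶠ κ v) (∈-allFin u) κu≡κv)
                                (∈-filter⁺ (λ w → κ w ≟ᶠ κ v) (∈-allFin v) refl) u≢v

injective⇒proper : ∀ {n m} (H : Graph n) {κ : Fin n → Fin m} →
  Injective _≡_ _≡_ κ → T (isProper H κ)
injective⇒proper {n} H {κ} inj =
  T-and (concat⁺ (map⁺ (All.universal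
    (λ u → map⁺ (All.universal (edgeOk u) (allFin n))) (allFin n))))
  where
  edgeOk : ∀ u v → T (not (adj H u v) ∨ not ⌊ κ u ≟ᶠ κ v ⌋)
  edgeOk u v with κ u ≟ᶠ κ v
  ... | no _ = Equivalence.from (T-∨ {not (adj H u v)}) (inj₂ _)
  ... | yes κu≡κv with inj κu≡κv
  ...   | refl rewrite irrfl H u = _

isProper∧hasContent-ones : ∀ {n m} (H : Graph n) (κ : Fin n → Fin m) →
  isProper H κ ∧ hasContent κ (const 1) ≡ hasContent κ (const 1)
isProper∧hasContent-ones H κ with hasContent κ (const 1) in eq
... | false = ∧-zeroʳ (isProper H κ)
... | true  = trans (∧-identityʳ (isProper H κ)) (Equivalence.to T-≡
                (injective⇒proper H (hasContent-ones⇒injective (Equivalence.from T-≡ eq))))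

-- Content (1, …, 1) on m colours singles out the bijections Fin m → Fin m, so this is m!.
bijectionCount : ℕ → ℕ
bijectionCount m = length (filter (λ κ → hasContent κ (const 1) ≟B true) (allFuns m m))

chromCoeff-ones : ∀ {k m} (H : Graph k) → k ≡ m → chromCoeff H m (const 1) ≡ bijectionCount m
chromCoeff-ones {k} H refl = cong length (filter-≐
  (λ κ → isProper H κ ∧ hasContent κ (const 1) ≟B true) (λ κ → hasContent κ (const 1) ≟B true)
  ( (λ {κ} → trans (sym (isProper∧hasContent-ones H κ)))
  , (λ {κ} → trans (isProper∧hasContent-ones H κ)))
  (allFuns k k))

fibreSize-identity : ∀ {n} {κ : Fin n → Fin n} → κ ≗ id → ∀ i → fibreSize κ i ≡ 1
fibreSize-identity {n} {κ} κ≗id i = begin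
  length (filter (λ v → κ v ≟ᶠ i) (allFin n))
    ≡⟨ cong length (filter-≐ _ _
         ((λ {v} → trans (sym (κ≗id v))) , (λ {v} → trans (κ≗id v))) (allFin n)) ⟩
  length (filter (_≟ᶠ i) (allFin n))
    ≡⟨ unique⇒count-member≡1 _≟ᶠ_ (Uniqueₚ.allFin⁺ n) (∈-allFin i) ⟩
  1 ∎
  where open ≡-Reasoning

allFuns-complete : ∀ n m (f : Fin n → Fin m) → Any (_≗ f) (allFuns n m)
allFuns-complete zero    m f = here (λ ())
allFuns-complete (suc n) m f = Anyₚ.concat⁺ (Anyₚ.map⁺ (Any.map
  (λ g≗f∘suc → Anyₚ.map⁺ (Any.map (λ { refl → λ { zero → refl ; (suc k) → g≗f∘suc k } })
                                    (∈-allFin (f zero))))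
  (allFuns-complete n m (f ∘ suc))))

bijectionCount-positive : ∀ m → 0 < bijectionCount m
bijectionCount-positive m = filter-some (λ κ → hasContent κ (const 1) ≟B true)
  (Any.map (λ {κ} κ≗id →
              Equivalence.to T-≡ (fibreSize⇒hasContent κ (const 1) (fibreSize-identity κ≗id)))
           (allFuns-complete m m id))

sumℚ-map-*ʳ : ∀ {A : Set} (f : A → ℚ) (q : ℚ) (xs : List A) →
  sumℚ (map (λ x → f x * q) xs) ≡ sumℚ (map f xs) * q
sumℚ-map-*ʳ f q []       = sym (*-zeroˡ q)
sumℚ-map-*ʳ f q (x ∷ xs) =
  trans (cong (f x * q +_) (sumℚ-map-*ʳ f q xs)) (sym (*-distribʳ-+ q (f x) (sumℚ (map f xs))))

*-cancelʳ-≡-pos : ∀ {p q} r .{{_ : Positive r}} → p * r ≡ q * r → p ≡ q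
*-cancelʳ-≡-pos r e =
  ℚₚ.≤-antisym (*-cancelʳ-≤-pos r (ℚₚ.≤-reflexive e))
               (*-cancelʳ-≤-pos r (ℚₚ.≤-reflexive (sym e)))

ℕtoℚ-pos : ∀ {k} → 0 < k → Positive (ℕtoℚ k)
ℕtoℚ-pos {suc k} _ = normalize-pos (suc k) 1

theorem3p5 : (Gs : (i : ℕ) → Graph i) → (∀ i → 1 ≤ i → Connected (Gs i)) →
    (n : ℕ) → (G : Graph n) →
    (ps : List (List ℕ)) → Unique ps →
    (∀ l → (l ∈ ps → IsPartition n l) × (IsPartition n l → l ∈ ps)) →
    (c : List ℕ → ℚ) →
    (∀ (m : ℕ) (α : Fin m → ℕ) →
    ℕtoℚ (chromCoeff G m α)
    ≡ sumℚ (map (λ lam → c lam * ℕtoℚ (chromCoeff (unionFamily Gs lam) m α)) ps)) →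
    sumℚ (map c ps) ≡ 1ℚ
theorem3p5 Gs _ n G ps _ partitions c expansion =
  *-cancelʳ-≡-pos k {{ℕtoℚ-pos (bijectionCount-positive n)}} (begin
    sumℚ (map c ps) * k
      ≡⟨ sym (sumℚ-map-*ʳ c k ps) ⟩
    sumℚ (map (λ l → c l * k) ps)
      ≡⟨ cong sumℚ (map-cong-local (All.tabulate λ {l} l∈ps →
           cong (λ z → c l * ℕtoℚ z) (sym (componentCoeff l∈ps)))) ⟩
    sumℚ (map (λ l → c l * ℕtoℚ (chromCoeff (unionFamily Gs l) n (const 1))) ps)
      ≡⟨ sym (expansion n (const 1)) ⟩
    ℕtoℚ (chromCoeff G n (const 1))
      ≡⟨ cong ℕtoℚ (chromCoeff-ones G refl) ⟩
    k
      ≡⟨ sym (*-identityˡ k) ⟩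
    1ℚ * k ∎)
  where
  open ≡-Reasoning
  k : ℚ
  k = ℕtoℚ (bijectionCount n)
  componentCoeff : ∀ {l} → l ∈ ps → chromCoeff (unionFamily Gs l) n (const 1) ≡ bijectionCount n
  componentCoeff {l} l∈ps = chromCoeff-ones (unionFamily Gs l) (proj₂ (proj₂ (proj₁ (partitions l) l∈ps)))
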